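{- For each $\mathcal{C}\in\{\mathrm{Horn},\mathrm{dHorn},\mathrm{Krom}\}$ and every integer $t\ge1$, the parameters $\mathrm{depth}_{\mathcal{C}}$ and $\mathrm{size}_{\mathcal{W}_t}$ are domination orthogonal.
   Context: A clause is a finite set of literals with no complementary pair; a CNF formula is a finite set of clauses. For a partial assignment $\tau$, $F[\tau]$ is obtained by deleting clauses containing a true literal and deleting false literals from the remaining clauses. The incidence graph of $F$ is the bipartite graph between variables and clauses ($x$ adjacent to $c$ iff $x$ or $\neg x$ is in $c$); $\mathrm{Conn}(F)$ is the set of its connected components. Horn: every clause has at most one positive literal; dHorn: at most one negative literal; Krom: at most two literals. $\mathcal{W}_t$ is the class of CNF formulas whose incidence graph has treewidth at most $t$. $\mathrm{depth}_{\mathcal{C}}(F)$ is $0$ if $F\in\mathcal{C}$; if $F\notin\mathcal{C}$ and $F$ is connected it is $1+\min_{x\in\mathit{var}(F)}\max_{\epsilon\in\{0,1\}}\mathrm{depth}_{\mathcal{C}}(F[x=\epsilon])$; otherwise it is $\max_{F'\in\mathrm{Conn}(F)}\mathrm{depth}_{\mathcal{C}}(F')$. For a class $\mathcal{D}$, $\mathrm{size}_{\mathcal{D}}(F)$ is the minimum size of a set $B\subseteq\mathit{var}(F)$ with $F[\tau]\in\mathcal{D}$ for all $\tau:B\to\{0,1\}$. For integer-valued parameters $p,q$: $p$ dominates $q$ if every class of formulas on which $q$ is bounded also has $p$ bounded; $p,q$ are domination orthogonal if neither dominates the other. -}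

module Defs where

open import Data.Nat using (ℕ; zero; suc; _+_; _≤_)
open import Data.Bool using (Bool; true; false; not; _∧_; if_then_else_)
import Data.Bool as B
open import Data.Maybe using (Maybe; just; nothing)
import Data.Maybe as M
open import Data.Product using (Σ; ∃; ∃-syntax; _×_; _,_; proj₁; proj₂)
import Data.Product.Properties as PP
open import Data.Sum using (_⊎_; inj₁; inj₂)
import Data.Sum.Properties as SP
open import Data.List using (List; []; _∷_; length; map; filter; concatMap; _++_)
import Data.List.Properties as LP
open import Data.List.Membership.Propositional using (_∈_)
open import Data.List.Relation.Unary.All using (All)
open import Data.List.Relation.Unary.Any using (Any)
open import Data.List.Relation.Unary.Unique.Propositional using (Unique)
open import Relation.Nullary using (¬_; Dec; yes; no)
open import Relation.Nullary.Decidable using (⌊_⌋)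
open import Relation.Binary.Definitions using (DecidableEquality)
open import Relation.Binary.PropositionalEquality using (_≡_)
open import Level using () renaming (suc to lsuc; zero to lzero)
import Data.List.Membership.DecPropositional as DecMem

-- CNF formulas
-- A literal is a pair (variable, polarity); polarity true = positive.
-- A clause is a list of literals, a formula a list of clauses; they
-- represent finite sets (well-formedness `WF` below is imposed on the
-- formulas ranged over by the classes in the domination notion).

Lit : Set
Lit = ℕ × Bool

var : Lit → ℕ
var = proj₁

pos : Lit → Bool
pos = proj₂

Clause : Set
Clause = List Lit

CNF : Set
CNF = List Clause

_≟L_ : DecidableEquality Lit
_≟L_ = PP.≡-dec Data.Nat._≟_ B._≟_
  where import Data.Nat

_≟C_ : DecidableEquality Clause
_≟C_ = LP.≡-dec _≟L_

WFClause : Clause → Set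
WFClause c = Unique c × (∀ {l l'} → l ∈ c → l' ∈ c → var l ≡ var l' → pos l ≡ pos l')

WF : CNF → Set
WF F = All WFClause F

vars : CNF → List ℕ
vars F = concatMap (map var) F

PAssign : Set
PAssign = ℕ → Maybe Bool

litVal : PAssign → Lit → Maybe Bool
litVal τ l = M.map (λ b → if pos l then b else not b) (τ (var l))

isTrue : PAssign → Lit → Bool
isTrue τ l with litVal τ l
... | just true = true
... | _ = false

isFalse : PAssign → Lit → Bool
isFalse τ l with litVal τ l
... | just false = true
... | _ = false

anyB : {A : Set} → (A → Bool) → List A → Bool
anyB p [] = false
anyB p (x ∷ xs) = p x B.∨ anyB p xs

filterB : {A : Set} → (A → Bool) → List A → List A
filterB p [] = []
filterB p (x ∷ xs) = if p x then x ∷ filterB p xs else filterB p xs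

_[_] : CNF → PAssign → CNF
F [ τ ] = map (filterB (λ l → not (isFalse τ l)))
              (filterB (λ c → not (anyB (isTrue τ) c)) F)

_≔_ : ℕ → Bool → PAssign
(x ≔ ε) y with Data.Nat._≟_ x y
  where import Data.Nat
... | yes _ = just ε
... | no _ = nothing

restrictTo : List ℕ → (ℕ → Bool) → PAssign
restrictTo Bs σ y = if ⌊ DecMem._∈?_ Data.Nat._≟_ y Bs ⌋ then just (σ y) else nothing
  where import Data.Nat

countB : {A : Set} → (A → Bool) → List A → ℕ
countB p [] = 0
countB p (x ∷ xs) = (if p x then 1 else 0) + countB p xs

Horn : CNF → Set
Horn F = All (λ c → countB pos c ≤ 1) F

dHorn : CNF → Set
dHorn F = All (λ c → countB (λ l → not (pos l)) c ≤ 1) F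

Krom : CNF → Set
Krom F = All (λ c → length c ≤ 2) F

data BaseClass : Set where
  horn dhorn krom : BaseClass

⟦_⟧ : BaseClass → CNF → Set
⟦ horn ⟧ = Horn
⟦ dhorn ⟧ = dHorn
⟦ krom ⟧ = Krom

-- Incidence graph: vertices are variables (inj₁) and clauses (inj₂)

Vertex : Set
Vertex = ℕ ⊎ Clause

_≟V_ : DecidableEquality Vertex
_≟V_ = SP.≡-dec Data.Nat._≟_ _≟C_
  where import Data.Nat

IVertex : CNF → Vertex → Set
IVertex F (inj₁ x) = x ∈ vars F
IVertex F (inj₂ c) = c ∈ F

IEdge : CNF → Vertex → Vertex → Set
IEdge F (inj₁ x) (inj₂ c) = c ∈ F × Any (λ l → var l ≡ x) c
IEdge F (inj₂ c) (inj₁ x) = c ∈ F × Any (λ l → var l ≡ x) c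
IEdge F _ _ = Data.Empty.⊥
  where import Data.Empty

data Reach (F : CNF) : Vertex → Vertex → Set where
  here : ∀ {u} → Reach F u u
  step : ∀ {u v w} → IEdge F u v → Reach F v w → Reach F u w

Connected : CNF → Set
Connected F = ∀ u w → IVertex F u → IVertex F w → Reach F u w

-- Every variable lies in a clause, so each
-- component contains a clause c and consists of the clauses reachable
-- from c (together with their variables).
IsComponent : CNF → CNF → Set
IsComponent F F' = Σ Clause λ c → c ∈ F ×
  (∀ d → (d ∈ F' → d ∈ F × Reach F (inj₂ c) (inj₂ d))
       × (d ∈ F × Reach F (inj₂ c) (inj₂ d) → d ∈ F'))

-- Parameters are given as relations  P F k  meaning  "p(F) ≤ k".

Param : Set₁
Param = CNF → ℕ → Set

data DepthLE (𝒞 : CNF → Set) : CNF → ℕ → Set where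
  base   : ∀ {F k} → 𝒞 F → DepthLE 𝒞 F k
  branch : ∀ {F k} (x : ℕ) → Connected F → x ∈ vars F →
           DepthLE 𝒞 (F [ x ≔ false ]) k → DepthLE 𝒞 (F [ x ≔ true ]) k →
           DepthLE 𝒞 F (suc k)
  split  : ∀ {F k} → (∀ F' → IsComponent F F' → DepthLE 𝒞 F' k) →
           DepthLE 𝒞 F k

SizeLE : (CNF → Set) → Param
SizeLE 𝒟 F k = Σ (List ℕ) λ Bs → length Bs ≤ k × All (_∈ vars F) Bs ×
  (∀ (σ : ℕ → Bool) → 𝒟 (F [ restrictTo Bs σ ]))

data TDTree : Set where
  node : List Vertex → List TDTree → TDTree

_∈ᵇ_ : Vertex → List Vertex → Bool
v ∈ᵇ b = ⌊ DecMem._∈?_ _≟V_ v b ⌋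

-- number of nodes whose bag contains v but whose parent's bag does not
-- (p = whether the parent's bag contains v); the nodes containing v form a
-- connected subtree iff this number is ≤ 1.
mutual
  tops : Vertex → Bool → TDTree → ℕ
  tops v p (node b ts) = (if (v ∈ᵇ b) ∧ not p then 1 else 0) + topsL v (v ∈ᵇ b) ts

  topsL : Vertex → Bool → List TDTree → ℕ
  topsL v p [] = 0
  topsL v p (t ∷ ts) = tops v p t + topsL v p ts

data SomeBag (P : List Vertex → Set) : TDTree → Set where
  here  : ∀ {b ts} → P b → SomeBag P (node b ts)
  there : ∀ {b ts} → Any (SomeBag P) ts → SomeBag P (node b ts)

data AllBags (P : List Vertex → Set) : TDTree → Set where
  node : ∀ {b ts} → P b → All (AllBags P) ts → AllBags P (node b ts)

IsTDWidth≤ : ℕ → CNF → TDTree → Set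
IsTDWidth≤ t F T =
    AllBags (All (IVertex F)) T
  × (∀ v → IVertex F v → SomeBag (v ∈_) T)
  × (∀ u v → IEdge F u v → SomeBag (λ b → u ∈ b × v ∈ b) T)
  × (∀ v → tops v false T ≤ 1)
  × AllBags (λ b → length b ≤ suc t) T

W : ℕ → CNF → Set
W t F = Σ TDTree (IsTDWidth≤ t F)

Bounded : Param → (CNF → Set) → Set
Bounded p 𝒦 = Σ ℕ λ k → ∀ F → WF F → 𝒦 F → p F k

Dominates : Param → Param → Set₁
Dominates p q = ∀ (𝒦 : CNF → Set) → Bounded q 𝒦 → Bounded p 𝒦

DominationOrthogonal : Param → Param → Set₁
DominationOrthogonal p q = ¬ Dominates p q × ¬ Dominates q p

-- Single clauses with pairwise distinct variables have a star as incidence graph, so size_{𝒲_t}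
-- is 0 on them; yet a clause of m literals of the polarity that 𝒞 restricts (positive for Horn and
-- Krom, negative for dHorn) has depth_𝒞 at least m - 2, as assigning a variable against that
-- polarity deletes one literal and satisfies none. Conversely, the clauses ¬xᵢ ∨ yⱼ (i, j < t+1+k)
-- form a Horn, dHorn and Krom formula, but after assigning any k variables the incidence graph
-- still contains a subdivided K_{t+1,t+1}. In a tree decomposition of it, descend from the root
-- into children in which some surviving xᵢ or yⱼ missing from the current bag occurs, as long as
-- possible. The final bag holds a surviving vertex v and, for each of the t + 1 partners u of v,
-- either u or the clause joining v and u: t + 2 vertices in all.

module Submission where

open import Defs
open import Data.Nat using (ℕ; suc; _+_; _≤_; _<_; z≤n; s≤s; _≟_)
open import Data.Nat.Properties
  using (≤-trans; ≤-refl; n≤1+n; m≤m+n; m≤n+m; <-irrefl; +-mono-≤; +-monoˡ-≤; +-suc; +-comm; +-cancelʳ-≤; +-cancelˡ-≡; module ≤-Reasoning)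
open import Data.Bool using (Bool; true; false; not; _∧_; if_then_else_)
import Data.Bool as Bool
open import Data.Bool.Properties using (∧-zeroʳ)
open import Data.Maybe using (nothing)
open import Data.Product using (∃; ∃₂; _×_; _,_; proj₁; proj₂)
open import Data.Sum using (_⊎_; inj₁; inj₂; [_,_])
open import Data.Sum.Properties using (inj₁-injective)
open import Data.List using (List; []; _∷_; length; map; _++_; upTo; filter; cartesianProductWith)
open import Data.List.Properties using (length-map; length-upTo; map-id-local)
open import Data.List.Membership.Propositional using (_∈_; _∉_; find)
open import Data.List.Membership.Propositional.Properties
  using (∈-++⁺ˡ; ∈-++⁺ʳ; ∈-++⁻; ∈-map⁺; ∈-map⁻; ∈-upTo⁺; ∈-upTo⁻; ∈-filter⁻; ∈-cartesianProductWith⁺; ∈-cartesianProductWith⁻)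
open import Data.List.Relation.Unary.All as All using (All; []; _∷_)
import Data.List.Relation.Unary.All.Properties as AllP
open import Data.List.Relation.Unary.Any as Any using (Any; here; there)
import Data.List.Relation.Unary.Any.Properties as AnyP
open import Data.List.Relation.Unary.AllPairs as AllPairs using (AllPairs; []; _∷_)
import Data.List.Relation.Unary.AllPairs.Properties as AllPairsP
open import Data.List.Relation.Unary.Unique.Propositional using (Unique)
import Data.List.Relation.Unary.Unique.Propositional.Properties as UniqueP
open import Data.Empty using (⊥; ⊥-elim)
open import Function using (_on_; _∘_; id)
open import Relation.Nullary using (¬_; Dec; yes; no; does)
open import Relation.Nullary.Decidable using (map′; _⊎-dec_; _×-dec_)
open import Relation.Binary.PropositionalEquality using (_≡_; _≢_; refl; sym; trans; cong; subst)
open import Data.List.Membership.DecPropositional _≟_ using (_∈?_; _∉?_)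
open import Data.List.Membership.DecPropositional _≟V_ using () renaming (_∈?_ to _∈ⱽ?_)
open import Relation.Unary using (Decidable)
open import Relation.Unary.Properties using (∁?)

filterB-idem : ∀ {A : Set} (p : A → Bool) xs → All (λ x → p x ≡ true) xs → filterB p xs ≡ xs
filterB-idem p [] [] = refl
filterB-idem p (x ∷ xs) (px ∷ pxs) rewrite px = cong (x ∷_) (filterB-idem p xs pxs)

All-filterB : ∀ {A : Set} {P : A → Set} (p : A → Bool) {xs} → All P xs → All P (filterB p xs)
All-filterB p [] = []
All-filterB p {x ∷ _} (px ∷ pxs) with p x
... | true = px ∷ All-filterB p pxs
... | false = All-filterB p pxs

AllPairs-filterB : ∀ {A : Set} {R : A → A → Set} (p : A → Bool) {xs} → AllPairs R xs → AllPairs R (filterB p xs)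
AllPairs-filterB p [] = []
AllPairs-filterB p {x ∷ _} (rx ∷ rxs) with p x
... | true = All-filterB p rx ∷ AllPairs-filterB p rxs
... | false = AllPairs-filterB p rxs

∈-filterB : ∀ {A : Set} (p : A → Bool) {x xs} → p x ≡ true → x ∈ xs → x ∈ filterB p xs
∈-filterB p {xs = y ∷ _} px (here refl) rewrite px = here refl
∈-filterB p {xs = y ∷ _} px (there x∈xs) with p y
... | true = there (∈-filterB p px x∈xs)
... | false = ∈-filterB p px x∈xs

length-filterB-∷ : ∀ {A : Set} (p : A → Bool) x xs → length (filterB p xs) ≤ length (filterB p (x ∷ xs))
length-filterB-∷ p x xs with p x
... | true = n≤1+n _
... | false = ≤-refl

anyB-false : ∀ {A : Set} (p : A → Bool) {xs} → All (λ x → p x ≡ false) xs → anyB p xs ≡ false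
anyB-false p [] = refl
anyB-false p (px ∷ pxs) rewrite px = anyB-false p pxs

countB-all : ∀ {A : Set} (p : A → Bool) {xs} → All (λ x → p x ≡ true) xs → countB p xs ≡ length xs
countB-all p [] = refl
countB-all p (px ∷ pxs) rewrite px = cong suc (countB-all p pxs)

Unique-⊆⇒length≤ : ∀ {A : Set} {xs ys : List A} → Unique xs → All (_∈ ys) xs → length xs ≤ length ys
Unique-⊆⇒length≤ [] [] = z≤n
Unique-⊆⇒length≤ {ys = ys} (x∉xs ∷ xs!) (x∈ys ∷ xs⊆ys) =
  subst (_ ≤_) (sym (length-─ x∈ys)) (s≤s (Unique-⊆⇒length≤ xs! (All.zipWith (∈-─ {x∈ys = x∈ys}) (x∉xs , xs⊆ys))))
  where
  length-─ : ∀ {x} {ys : List _} (x∈ys : x ∈ ys) → length ys ≡ suc (length (ys Any.─ x∈ys))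
  length-─ (here refl) = refl
  length-─ {ys = _ ∷ _ ∷ _} (there x∈ys) = cong suc (length-─ x∈ys)
  length-─ {ys = _ ∷ []} (there ())
  ∈-─ : ∀ {x y} {ys : List _} {x∈ys : x ∈ ys} → x ≢ y × y ∈ ys → y ∈ (ys Any.─ x∈ys)
  ∈-─ {x∈ys = here refl} (x≢y , here refl) = ⊥-elim (x≢y refl)
  ∈-─ {x∈ys = here refl} (_ , there y∈ys) = y∈ys
  ∈-─ {x∈ys = there _} (_ , here refl) = here refl
  ∈-─ {x∈ys = there x∈ys} (x≢y , there y∈ys) = there (∈-─ (x≢y , y∈ys))

DistinctVars : Clause → Set
DistinctVars = AllPairs (_≢_ on var)

DistinctVars⇒WFClause : ∀ {c} → DistinctVars c → WFClause c
DistinctVars⇒WFClause dv = AllPairs.map (λ var≢ eq → var≢ (cong var eq)) dv , samePolarity dv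
  where
  samePolarity : ∀ {c} → DistinctVars c → ∀ {l l'} → l ∈ c → l' ∈ c → var l ≡ var l' → pos l ≡ pos l'
  samePolarity (_ ∷ _) (here refl) (here refl) _ = refl
  samePolarity (l≢ ∷ _) (here refl) (there l'∈c) eq = ⊥-elim (All.lookup l≢ l'∈c eq)
  samePolarity (l≢ ∷ _) (there l∈c) (here refl) eq = ⊥-elim (All.lookup l≢ l∈c (sym eq))
  samePolarity (_ ∷ dv) (there l∈c) (there l'∈c) eq = samePolarity dv l∈c l'∈c eq

∈-vars⁺ : ∀ {F c l} → c ∈ F → l ∈ c → var l ∈ vars F
∈-vars⁺ {c ∷ F} (here refl) l∈c = ∈-++⁺ˡ (∈-map⁺ var l∈c)
∈-vars⁺ {d ∷ F} (there c∈F) l∈c = ∈-++⁺ʳ (map var d) (∈-vars⁺ c∈F l∈c)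

∈-vars⁻ : ∀ {F x} → x ∈ vars F → ∃₂ λ c l → c ∈ F × l ∈ c × var l ≡ x
∈-vars⁻ {c ∷ F} x∈vars with ∈-++⁻ (map var c) x∈vars
... | inj₁ x∈c = let l , l∈c , x≡l = ∈-map⁻ var x∈c in c , l , here refl , l∈c , sym x≡l
... | inj₂ x∈F = let d , l , d∈F , l∈d , l≡x = ∈-vars⁻ x∈F in d , l , there d∈F , l∈d , l≡x

Unassigned : PAssign → Lit → Set
Unassigned τ l = τ (var l) ≡ nothing

restrictClause : PAssign → Clause → Clause
restrictClause τ = filterB (λ l → not (isFalse τ l))

restrict-noTrue : ∀ τ F → All (λ c → anyB (isTrue τ) c ≡ false) F → F [ τ ] ≡ map (restrictClause τ) F
restrict-noTrue τ F noTrue = cong (map (restrictClause τ)) (filterB-idem _ F (All.map (cong not) noTrue))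

isTrue-unassigned : ∀ τ l → Unassigned τ l → isTrue τ l ≡ false
isTrue-unassigned τ l unassigned rewrite unassigned = refl

isFalse-unassigned : ∀ τ l → Unassigned τ l → isFalse τ l ≡ false
isFalse-unassigned τ l unassigned rewrite unassigned = refl

noTrue-unassigned : ∀ τ {c} → All (Unassigned τ) c → anyB (isTrue τ) c ≡ false
noTrue-unassigned τ unassigned = anyB-false (isTrue τ) (All.map (isTrue-unassigned τ _) unassigned)

restrictClause-unassigned : ∀ τ {c} → All (Unassigned τ) c → restrictClause τ c ≡ c
restrictClause-unassigned τ unassigned =
  filterB-idem _ _ (All.map (cong not ∘ isFalse-unassigned τ _) unassigned)

∈-restrict-unassigned : ∀ τ {F c} → c ∈ F → All (Unassigned τ) c → c ∈ F [ τ ]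
∈-restrict-unassigned τ {F} c∈F unassigned =
  subst (_∈ F [ τ ]) (restrictClause-unassigned τ unassigned)
    (∈-map⁺ (restrictClause τ) (∈-filterB (λ c → not (anyB (isTrue τ) c)) (cong not (noTrue-unassigned τ unassigned)) c∈F))

restrict-unassigned : ∀ τ F → All (All (Unassigned τ)) F → F [ τ ] ≡ F
restrict-unassigned τ F unassigned =
  trans (restrict-noTrue τ F (All.map (noTrue-unassigned τ) unassigned))
        (map-id-local (All.map (restrictClause-unassigned τ) unassigned))

restrictTo-∉ : ∀ Bs σ {y} → y ∉ Bs → restrictTo Bs σ y ≡ nothing
restrictTo-∉ Bs σ {y} y∉Bs with y ∈? Bs
... | yes y∈Bs = ⊥-elim (y∉Bs y∈Bs)
... | no _ = refl

≔-≢ : ∀ {x y} e → x ≢ y → (x ≔ e) y ≡ nothing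
≔-≢ {x} {y} e x≢y with x ≟ y
... | yes x≡y = ⊥-elim (x≢y x≡y)
... | no _ = refl

isTrue-≔-not : ∀ x b {l} → pos l ≡ b → isTrue (x ≔ not b) l ≡ false
isTrue-≔-not x b {y , .b} refl with x ≟ y
isTrue-≔-not x true {y , .true} refl | yes _ = refl
isTrue-≔-not x false {y , .false} refl | yes _ = refl
... | no _ = refl

length-restrictClause-≔ : ∀ x e {c} → DistinctVars c → length c ≤ suc (length (restrictClause (x ≔ e) c))
length-restrictClause-≔ x e [] = z≤n
length-restrictClause-≔ x e {l ∷ c} (l≢ ∷ dv) = byCases (x ≟ var l)
  where
  byCases : Dec (x ≡ var l) → length (l ∷ c) ≤ suc (length (restrictClause (x ≔ e) (l ∷ c)))
  byCases (no x≢l) rewrite isFalse-unassigned (x ≔ e) l (≔-≢ e x≢l) = s≤s (length-restrictClause-≔ x e dv)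
  byCases (yes refl) = s≤s (subst (λ c' → length c' ≤ length (restrictClause (var l ≔ e) (l ∷ c)))
                                  (restrictClause-unassigned (var l ≔ e) (All.map (≔-≢ e) l≢))
                                  (length-filterB-∷ (λ l' → not (isFalse (var l ≔ e) l')) l c))

record MonotoneCopies (b : Bool) (F : CNF) (c : Clause) : Set where
  field
    copies   : All (_≡ c) F
    member   : c ∈ F
    monotone : All (λ l → pos l ≡ b) c
    distinct : DistinctVars c
open MonotoneCopies

MonotoneCopies-IsComponent : ∀ {b F c} → MonotoneCopies b F c → IsComponent F F
MonotoneCopies-IsComponent {F = F} {c} M = c , member M , λ d →
  (λ d∈F → d∈F , subst (λ d' → Reach F (inj₂ c) (inj₂ d')) (sym (All.lookup (copies M) d∈F)) here) , proj₁

MonotoneCopies-≔-not : ∀ x {b F c} → MonotoneCopies b F c →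
                       MonotoneCopies b (F [ x ≔ not b ]) (restrictClause (x ≔ not b) c)
MonotoneCopies-≔-not x {b} {F} {c} M = record
  { copies   = subst (All (_≡ restrictClause τ c)) (sym F[τ]≡) (AllP.map⁺ (All.map (cong (restrictClause τ)) (copies M)))
  ; member   = subst (restrictClause τ c ∈_) (sym F[τ]≡) (∈-map⁺ (restrictClause τ) (member M))
  ; monotone = All-filterB _ (monotone M)
  ; distinct = AllPairs-filterB _ (distinct M)
  }
  where
  τ : PAssign
  τ = x ≔ not b
  F[τ]≡ : F [ τ ] ≡ map (restrictClause τ) F
  F[τ]≡ = restrict-noTrue τ F (All.map (λ d≡c → subst (λ d → anyB (isTrue τ) d ≡ false) (sym d≡c)
            (anyB-false (isTrue τ) (All.map (isTrue-≔-not x b) (monotone M)))) (copies M))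

MonotoneClausesShort : (CNF → Set) → Bool → Set
MonotoneClausesShort 𝒦 b = ∀ {F c} → 𝒦 F → c ∈ F → All (λ l → pos l ≡ b) c → length c ≤ 2

MonotoneCopies⇒length≤2+depth : ∀ b {𝒦 F c k} → MonotoneClausesShort 𝒦 b → MonotoneCopies b F c →
                                DepthLE 𝒦 F k → length c ≤ 2 + k
MonotoneCopies⇒length≤2+depth b short M (base inClass) = ≤-trans (short inClass (member M) (monotone M)) (m≤m+n 2 _)
MonotoneCopies⇒length≤2+depth b short M (split components) =
  MonotoneCopies⇒length≤2+depth b short M (components _ (MonotoneCopies-IsComponent M))
MonotoneCopies⇒length≤2+depth true short M (branch x _ _ depth₀ _) =
  ≤-trans (length-restrictClause-≔ x false (distinct M))
          (s≤s (MonotoneCopies⇒length≤2+depth true short (MonotoneCopies-≔-not x M) depth₀))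
MonotoneCopies⇒length≤2+depth false short M (branch x _ _ _ depth₁) =
  ≤-trans (length-restrictClause-≔ x true (distinct M))
          (s≤s (MonotoneCopies⇒length≤2+depth false short (MonotoneCopies-≔-not x M) depth₁))

longPolarity : BaseClass → Bool
longPolarity horn = true
longPolarity dhorn = false
longPolarity krom = true

monotoneClausesShort : ∀ 𝒞 → MonotoneClausesShort ⟦ 𝒞 ⟧ (longPolarity 𝒞)
monotoneClausesShort horn inHorn c∈F mono =
  ≤-trans (subst (_≤ 1) (countB-all pos mono) (All.lookup inHorn c∈F)) (n≤1+n 1)
monotoneClausesShort dhorn inDHorn c∈F mono =
  ≤-trans (subst (_≤ 1) (countB-all _ (All.map (cong not) mono)) (All.lookup inDHorn c∈F)) (n≤1+n 1)
monotoneClausesShort krom inKrom c∈F _ = All.lookup inKrom c∈F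

monotoneClause : Bool → ℕ → Clause
monotoneClause b m = map (_, b) (upTo m)

MonotoneCopies-monotoneClause : ∀ b m → MonotoneCopies b (monotoneClause b m ∷ []) (monotoneClause b m)
MonotoneCopies-monotoneClause b m = record
  { copies   = refl ∷ []
  ; member   = here refl
  ; monotone = AllP.map⁺ (All.universal (λ _ → refl) (upTo m))
  ; distinct = AllPairsP.map⁺ (UniqueP.upTo⁺ m)
  }

length-monotoneClause : ∀ b m → length (monotoneClause b m) ≡ m
length-monotoneClause b m = trans (length-map _ (upTo m)) (length-upTo m)

∈ᵇ-true : ∀ {v b} → v ∈ b → (v ∈ᵇ b) ≡ true
∈ᵇ-true {v} {b} v∈b with v ∈ⱽ? b
... | yes _ = refl
... | no v∉b = ⊥-elim (v∉b v∈b)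

∈ᵇ-false : ∀ {v b} → v ∉ b → (v ∈ᵇ b) ≡ false
∈ᵇ-false {v} {b} v∉b with v ∈ⱽ? b
... | yes v∈b = ⊥-elim (v∉b v∈b)
... | no _ = refl

mutual
  SomeBag-map : ∀ {P Q : List Vertex → Set} → (∀ {b} → P b → Q b) → ∀ {T} → SomeBag P T → SomeBag Q T
  SomeBag-map f (here p) = here (f p)
  SomeBag-map f (there ps) = there (SomeBags-map f ps)

  SomeBags-map : ∀ {P Q : List Vertex → Set} → (∀ {b} → P b → Q b) → ∀ {Ts} → Any (SomeBag P) Ts → Any (SomeBag Q) Ts
  SomeBags-map f (here p) = here (SomeBag-map f p)
  SomeBags-map f (there ps) = there (SomeBags-map f ps)

leafBag : Clause → Lit → List Vertex
leafBag c l = inj₂ c ∷ inj₁ (var l) ∷ []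

leaf : Clause → Lit → TDTree
leaf c l = node (leafBag c l) []

star : Clause → TDTree
star c = node (inj₂ c ∷ []) (map (leaf c) c)

module _ {c : Clause} where

  leaf-covers : ∀ {l} → l ∈ c → Any (SomeBag (λ b → inj₂ c ∈ b × inj₁ (var l) ∈ b)) (map (leaf c) c)
  leaf-covers l∈c = AnyP.map⁺ (Any.map (λ { refl → here (here refl , there (here refl)) }) l∈c)

  star-bags : AllBags (All (IVertex (c ∷ []))) (star c)
  star-bags = node (here refl ∷ [])
    (AllP.map⁺ (All.tabulate (λ l∈c → node (here refl ∷ ∈-vars⁺ {c ∷ []} (here refl) l∈c ∷ []) [])))

  star-vertices : ∀ v → IVertex (c ∷ []) v → SomeBag (v ∈_) (star c)
  star-vertices (inj₂ _) (here refl) = here (here refl)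
  star-vertices (inj₁ x) x∈vars with ∈-vars⁻ {c ∷ []} x∈vars
  ... | _ , l , here refl , l∈c , refl = there (SomeBags-map proj₂ (leaf-covers l∈c))

  star-edges : ∀ u v → IEdge (c ∷ []) u v → SomeBag (λ b → u ∈ b × v ∈ b) (star c)
  star-edges (inj₁ x) (inj₂ _) (here refl , x∈c) with find x∈c
  ... | l , l∈c , refl = there (SomeBags-map (λ (c∈b , l∈b) → l∈b , c∈b) (leaf-covers l∈c))
  star-edges (inj₂ _) (inj₁ x) (here refl , x∈c) with find x∈c
  ... | l , l∈c , refl = there (leaf-covers l∈c)

  topsL-leaves-inParent : ∀ v ls → topsL v true (map (leaf c) ls) ≡ 0
  topsL-leaves-inParent v [] = refl
  topsL-leaves-inParent v (l ∷ ls) rewrite ∧-zeroʳ (v ∈ᵇ leafBag c l) = topsL-leaves-inParent v ls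

  topsL-leaves-absent : ∀ v ls → v ≢ inj₂ c → All (λ l → v ≢ inj₁ (var l)) ls → topsL v false (map (leaf c) ls) ≡ 0
  topsL-leaves-absent v [] _ _ = refl
  topsL-leaves-absent v (l ∷ ls) v≢c (v≢l ∷ v≢ls)
    rewrite ∈ᵇ-false {v} {leafBag c l} (λ { (here v≡c) → v≢c v≡c ; (there (here v≡l)) → v≢l v≡l }) =
    topsL-leaves-absent v ls v≢c v≢ls

  topsL-leaves : ∀ v {ls} → v ≢ inj₂ c → DistinctVars ls → topsL v false (map (leaf c) ls) ≤ 1
  topsL-leaves v _ [] = z≤n
  topsL-leaves v {l ∷ ls} v≢c (l≢ ∷ dv) = byCases (v ≟V inj₁ (var l))
    where
    byCases : Dec (v ≡ inj₁ (var l)) → topsL v false (map (leaf c) (l ∷ ls)) ≤ 1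
    byCases (yes refl)
      rewrite ∈ᵇ-true {inj₁ (var l)} {leafBag c l} (there (here refl))
            | topsL-leaves-absent (inj₁ (var l)) ls v≢c (All.map (λ var≢ eq → var≢ (inj₁-injective eq)) l≢) = ≤-refl
    byCases (no v≢l)
      rewrite ∈ᵇ-false {v} {leafBag c l} (λ { (here v≡c) → v≢c v≡c ; (there (here v≡l)) → v≢l v≡l }) =
      topsL-leaves v v≢c dv

  star-tops : DistinctVars c → ∀ v → tops v false (star c) ≤ 1
  star-tops dv v = byCases (v ≟V inj₂ c)
    where
    byCases : Dec (v ≡ inj₂ c) → tops v false (star c) ≤ 1
    byCases (yes refl) rewrite ∈ᵇ-true {inj₂ c} {inj₂ c ∷ []} (here refl) | topsL-leaves-inParent (inj₂ c) c = ≤-refl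
    byCases (no v≢c) rewrite ∈ᵇ-false {v} {inj₂ c ∷ []} (λ { (here v≡c) → v≢c v≡c }) = topsL-leaves v v≢c dv

  star-width : ∀ {t} → 1 ≤ t → AllBags (λ b → length b ≤ suc t) (star c)
  star-width 1≤t = node (s≤s z≤n) (AllP.map⁺ (All.universal (λ _ → node (s≤s 1≤t) []) c))

star-W : ∀ {t} → 1 ≤ t → ∀ {c} → DistinctVars c → W t (c ∷ [])
star-W 1≤t {c} dv = star c , star-bags , star-vertices , star-edges , star-tops dv , star-width 1≤t

SingleClause : CNF → Set
SingleClause F = ∃ λ c → F ≡ c ∷ [] × DistinctVars c

size-bounded-SingleClause : ∀ {t} → 1 ≤ t → Bounded (SizeLE (W t)) SingleClause
size-bounded-SingleClause {t} 1≤t = 0 , λ { _ _ (c , refl , dv) → [] , z≤n , [] , λ σ →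
  subst (W t) (sym (restrict-unassigned (restrictTo [] σ) (c ∷ []) (All.universal (λ _ → refl) c ∷ [])))
        (star-W 1≤t dv) }

depth-unbounded-SingleClause : ∀ 𝒞 → ¬ Bounded (DepthLE ⟦ 𝒞 ⟧) SingleClause
depth-unbounded-SingleClause 𝒞 (k , depth≤k) =
  <-irrefl refl (subst (_≤ 2 + k) (length-monotoneClause b (3 + k))
    (MonotoneCopies⇒length≤2+depth b (monotoneClausesShort 𝒞) M
      (depth≤k (c ∷ []) (DistinctVars⇒WFClause (distinct M) ∷ []) (c , refl , distinct M))))
  where
  b = longPolarity 𝒞
  c = monotoneClause b (3 + k)
  M = MonotoneCopies-monotoneClause b (3 + k)

depth-doesNotDominate-size : ∀ 𝒞 {t} → 1 ≤ t → ¬ Dominates (DepthLE ⟦ 𝒞 ⟧) (SizeLE (W t))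
depth-doesNotDominate-size 𝒞 1≤t dominates =
  depth-unbounded-SingleClause 𝒞 (dominates SingleClause (size-bounded-SingleClause 1≤t))

Occurs : Vertex → TDTree → Set
Occurs v = SomeBag (v ∈_)

mutual
  occurs? : ∀ v T → Dec (Occurs v T)
  occurs? v (node b Ts) = map′ [ here , there ] (λ { (here v∈b) → inj₁ v∈b ; (there below) → inj₂ below })
                               (v ∈ⱽ? b ⊎-dec occursIn? v Ts)

  occursIn? : ∀ v Ts → Dec (Any (Occurs v) Ts)
  occursIn? v [] = no λ ()
  occursIn? v (T ∷ Ts) = map′ [ here , there ] (λ { (here o) → inj₁ o ; (there os) → inj₂ os })
                              (occurs? v T ⊎-dec occursIn? v Ts)

mutual
  tops-occurs : ∀ {w T} → Occurs w T → 1 ≤ tops w false T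
  tops-occurs {w} {node b Ts} (here w∈b) rewrite ∈ᵇ-true w∈b = s≤s z≤n
  tops-occurs {w} {node b Ts} (there below) with w ∈ᵇ b
  ... | true = s≤s z≤n
  ... | false = topsL-occurs below

  topsL-occurs : ∀ {w Ts} → Any (Occurs w) Ts → 1 ≤ topsL w false Ts
  topsL-occurs (here o) = ≤-trans (tops-occurs o) (m≤m+n _ _)
  topsL-occurs (there os) = ≤-trans (topsL-occurs os) (m≤n+m _ _)

-- The bound on tops w p T, where p records whether the parent bag holds w: such a w must not
-- reappear as a new top below it, any other vertex may do so once.
topBound : Bool → ℕ
topBound true = 0
topBound false = 1

TopsBounded : (Vertex → Bool) → TDTree → Set
TopsBounded inParent T = ∀ w → tops w (inParent w) T ≤ topBound (inParent w)

TopsBoundedIn : List Vertex → List TDTree → Set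
TopsBoundedIn b Ts = ∀ w → topsL w (w ∈ᵇ b) Ts ≤ topBound (w ∈ᵇ b)

TopsBounded-children : ∀ {inParent b Ts} → TopsBounded inParent (node b Ts) → TopsBoundedIn b Ts
TopsBounded-children {inParent} {b} bounded w = descend (inParent w) (w ∈ᵇ b) (bounded w)
  where
  descend : ∀ p q {n} → (if q ∧ not p then 1 else 0) + n ≤ topBound p → n ≤ topBound q
  descend true true n≤0 = n≤0
  descend false true (s≤s n≤0) = n≤0
  descend true false n≤0 = ≤-trans n≤0 z≤n
  descend false false n≤1 = n≤1

absentBelow⇒absentAbove : ∀ {inParent b Ts w} → TopsBounded inParent (node b Ts) → (w ∈ᵇ b) ≡ false →
                          Any (Occurs w) Ts → inParent w ≡ false
absentBelow⇒absentAbove {inParent} {b} {Ts} {w} bounded w∉b below =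
  absent (inParent w) (subst (λ q → (if q ∧ not (inParent w) then 1 else 0) + topsL w q Ts ≤ topBound (inParent w))
                              w∉b (bounded w))
  where
  absent : ∀ p → topsL w false Ts ≤ topBound p → p ≡ false
  absent true n≤0 with ≤-trans (topsL-occurs below) n≤0
  ... | ()
  absent false _ = refl

absent⇒inOneChild : ∀ {b T Ts w} → TopsBoundedIn b (T ∷ Ts) → (w ∈ᵇ b) ≡ false →
                    Occurs w T → ¬ Any (Occurs w) Ts
absent⇒inOneChild {b} {T} {Ts} {w} bounded w∉b o os with
  ≤-trans (+-mono-≤ (tops-occurs o) (topsL-occurs os))
          (subst (λ q → tops w q T + topsL w q Ts ≤ topBound q) w∉b (bounded w))
... | s≤s ()

module _ (F : CNF) (Ls : List Vertex) where

  Blocks : Vertex → List Vertex → Set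
  Blocks v b = ∀ {c u} → u ∈ Ls → IEdge F v c → IEdge F c u → u ∈ b ⊎ c ∈ b

  Blocking : List Vertex → Set
  Blocking b = ∃ λ v → v ∈ Ls × v ∈ b × Blocks v b

  CoveredBelow : (Vertex → Bool) → TDTree → Set
  CoveredBelow inParent T = ∀ w → inParent w ≡ false → Occurs w T →
    ∀ u → IEdge F w u → SomeBag (λ b → w ∈ b × u ∈ b) T

  CoveredBelowIn : List Vertex → List TDTree → Set
  CoveredBelowIn b Ts = ∀ w → (w ∈ᵇ b) ≡ false → Any (Occurs w) Ts →
    ∀ u → IEdge F w u → Any (SomeBag (λ b' → w ∈ b' × u ∈ b')) Ts

  CoveredBelow-children : ∀ {inParent b Ts} → TopsBounded inParent (node b Ts) →
                          CoveredBelow inParent (node b Ts) → CoveredBelowIn b Ts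
  CoveredBelow-children bounded covered w w∉b below u edge
    with covered w (absentBelow⇒absentAbove bounded w∉b below) (there below) u edge
  ... | here (w∈b , _) with trans (sym (∈ᵇ-true w∈b)) w∉b
  ...   | ()
  CoveredBelow-children bounded covered w w∉b below u edge | there covering = covering

  StartsBelow : List Vertex → TDTree → Set
  StartsBelow b T = Any (λ w → (w ∈ᵇ b) ≡ false × Occurs w T) Ls

  startsBelow? : ∀ b T → Dec (StartsBelow b T)
  startsBelow? b T = Any.any? (λ w → ((w ∈ᵇ b) Bool.≟ false) ×-dec occurs? w T) Ls

  -- When no vertex of Ls starts below b, every occurrence below b of a vertex of Ls is connected
  -- to b, so b holds it; a path v — c — u is then caught either at c or, via the subtree holding
  -- the edge v — c, at u.
  blocking-here : ∀ {inParent b Ts} → TopsBounded inParent (node b Ts) → CoveredBelow inParent (node b Ts) →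
                  ¬ Any (StartsBelow b) Ts → Any (λ v → inParent v ≡ false × Occurs v (node b Ts)) Ls →
                  Blocking b
  blocking-here {inParent} {b} {Ts} bounded covered noneStarts start with find start
  ... | v , v∈Ls , v∉parent , v-occurs = v , v∈Ls , held v∈Ls v-occurs , blocks
    where
    held : ∀ {w} → w ∈ Ls → Occurs w (node b Ts) → w ∈ b
    held w∈Ls (here w∈b) = w∈b
    held {w} w∈Ls (there below) with w ∈ⱽ? b
    ... | yes w∈b = w∈b
    ... | no w∉b = ⊥-elim (noneStarts (Any.map (λ o → Any.map (λ { refl → ∈ᵇ-false w∉b , o }) w∈Ls) below))

    blocks : Blocks v b
    blocks {c} {u} u∈Ls vc cu with covered v v∉parent v-occurs c vc
    ... | here (_ , c∈b) = inj₂ c∈b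
    ... | there vc-below with c ∈ⱽ? b
    ...   | yes c∈b = inj₂ c∈b
    ...   | no c∉b with covered c (absentBelow⇒absentAbove bounded (∈ᵇ-false c∉b) c-below) (there c-below) u cu
      where
      c-below : Any (Occurs c) Ts
      c-below = SomeBags-map proj₂ vc-below
    ...     | here (_ , u∈b) = inj₁ u∈b
    ...     | there cu-below = inj₁ (held u∈Ls (there (SomeBags-map proj₂ cu-below)))

  mutual
    blockingBag : ∀ T inParent → TopsBounded inParent T → CoveredBelow inParent T →
                  Any (λ v → inParent v ≡ false × Occurs v T) Ls → SomeBag Blocking T
    blockingBag (node b Ts) inParent bounded covered start with Any.any? (startsBelow? b) Ts
    ... | yes starts = there (blockingBagIn b Ts starts (TopsBounded-children {Ts = Ts} bounded)
                                                        (CoveredBelow-children bounded covered))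
    ... | no noneStarts = here (blocking-here bounded covered noneStarts start)

    blockingBagIn : ∀ b Ts → Any (StartsBelow b) Ts → TopsBoundedIn b Ts → CoveredBelowIn b Ts →
                    Any (SomeBag Blocking) Ts
    blockingBagIn b (T ∷ Ts) (here starts) bounded covered =
      here (blockingBag T (_∈ᵇ b) (λ w → ≤-trans (m≤m+n _ _) (bounded w)) coveredHere starts)
      where
      coveredHere : CoveredBelow (_∈ᵇ b) T
      coveredHere w w∉b o u edge with covered w w∉b (here o) u edge
      ... | here covering = covering
      ... | there covering = ⊥-elim (absent⇒inOneChild bounded w∉b o (SomeBags-map proj₁ covering))
    blockingBagIn b (T ∷ Ts) (there starts) bounded covered =
      there (blockingBagIn b Ts starts (λ w → ≤-trans (m≤n+m _ _) (bounded w)) coveredLater)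
      where
      coveredLater : CoveredBelowIn b Ts
      coveredLater w w∉b os u edge with covered w w∉b (there os) u edge
      ... | there covering = covering
      ... | here covering = ⊥-elim (absent⇒inOneChild bounded w∉b (SomeBag-map proj₁ covering) os)

  blockingBag-TD : ∀ {t T} → IsTDWidth≤ t F T → Any (λ v → Occurs v T) Ls → SomeBag Blocking T
  blockingBag-TD (_ , _ , edges , connected , _) start =
    blockingBag _ (λ _ → false) connected (λ w _ _ → edges w) (Any.map (refl ,_) start)

-- The clause ¬xᵢ ∨ yⱼ, with xᵢ the variable i and yⱼ the variable N + j.
bicliqueClause : ℕ → ℕ → ℕ → Clause
bicliqueClause N i j = (i , false) ∷ (N + j , true) ∷ []

biclique : ℕ → CNF
biclique N = cartesianProductWith (bicliqueClause N) (upTo N) (upTo N)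

All-biclique : ∀ {P : Clause → Set} N → (∀ {i j} → i < N → j < N → P (bicliqueClause N i j)) → All P (biclique N)
All-biclique {P} N p = All.tabulate clause
  where
  clause : ∀ {c} → c ∈ biclique N → P c
  clause c∈F with ∈-cartesianProductWith⁻ (bicliqueClause N) (upTo N) (upTo N) c∈F
  ... | _ , _ , i∈ , j∈ , refl = p (∈-upTo⁻ i∈) (∈-upTo⁻ j∈)

∈-biclique : ∀ {N i j} → i < N → j < N → bicliqueClause N i j ∈ biclique N
∈-biclique i<N j<N = ∈-cartesianProductWith⁺ (bicliqueClause _) (∈-upTo⁺ i<N) (∈-upTo⁺ j<N)

<⇒≢+ : ∀ {i N} j → i < N → i ≢ N + j
<⇒≢+ {N = N} j i<N i≡N+j = <-irrefl i≡N+j (≤-trans i<N (m≤m+n N j))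

biclique-WF : ∀ N → WF (biclique N)
biclique-WF N = All-biclique N (λ {_} {j} i<N _ → DistinctVars⇒WFClause ((<⇒≢+ j i<N ∷ []) ∷ [] ∷ []))

biclique-inClass : ∀ 𝒞 N → ⟦ 𝒞 ⟧ (biclique N)
biclique-inClass horn N = All-biclique N (λ _ _ → ≤-refl)
biclique-inClass dhorn N = All-biclique N (λ _ _ → ≤-refl)
biclique-inClass krom N = All-biclique N (λ _ _ → ≤-refl)

length-filter-∁ : ∀ {A : Set} {P : A → Set} (P? : Decidable P) xs →
                  length (filter P? xs) + length (filter (∁? P?) xs) ≡ length xs
length-filter-∁ P? [] = refl
length-filter-∁ P? (x ∷ xs) with P? x
... | yes _ = cong suc (length-filter-∁ P? xs)
... | no _ = trans (+-suc _ _) (cong suc (length-filter-∁ P? xs))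

survivors : List ℕ → (ℕ → ℕ) → ℕ → List ℕ
survivors Bs f N = filter (λ i → f i ∉? Bs) (upTo N)

length-survivors : ∀ Bs f t k → (∀ {a b} → f a ≡ f b → a ≡ b) → length Bs ≤ k →
                   suc t ≤ length (survivors Bs f (suc t + k))
length-survivors Bs f t k f-injective |Bs|≤k = +-cancelʳ-≤ k (suc t) (length survivors′) (begin
  suc t + k                         ≡⟨ sym (length-upTo N) ⟩
  length (upTo N)                   ≡⟨ sym (length-filter-∁ inBs? (upTo N)) ⟩
  length hit + length survivors′    ≤⟨ +-monoˡ-≤ _ |hit|≤k ⟩
  k + length survivors′             ≡⟨ +-comm k _ ⟩
  length survivors′ + k             ∎)
  where
  open ≤-Reasoning
  N : ℕ
  N = suc t + k
  inBs? : Decidable (λ i → f i ∈ Bs)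
  inBs? i = f i ∈? Bs
  hit survivors′ : List ℕ
  hit = filter inBs? (upTo N)
  survivors′ = survivors Bs f N
  |hit|≤k : length hit ≤ k
  |hit|≤k = ≤-trans (subst (_≤ length Bs) (length-map f hit)
                      (Unique-⊆⇒length≤ (UniqueP.map⁺ f-injective (UniqueP.filter⁺ inBs? (UniqueP.upTo⁺ N)))
                                        (AllP.map⁺ (All.tabulate (proj₂ ∘ ∈-filter⁻ inBs?)))))
                    |Bs|≤k

survivor : ∀ {Bs f N i} → i ∈ survivors Bs f N → i < N × f i ∉ Bs
survivor {Bs} {f} i∈ = let i∈upTo , fi∉Bs = ∈-filter⁻ (λ i → f i ∉? Bs) i∈ in ∈-upTo⁻ i∈upTo , fi∉Bs

biclique-survives : ∀ {Bs N i j} σ → i ∈ survivors Bs id N → j ∈ survivors Bs (N +_) N →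
                    bicliqueClause N i j ∈ biclique N [ restrictTo Bs σ ]
biclique-survives {Bs} σ i∈X j∈Y with survivor i∈X | survivor j∈Y
... | i<N , i∉Bs | j<N , N+j∉Bs =
  ∈-restrict-unassigned (restrictTo Bs σ) (∈-biclique i<N j<N) (restrictTo-∉ Bs σ i∉Bs ∷ restrictTo-∉ Bs σ N+j∉Bs ∷ [])

SomeBag-AllBags : ∀ {P Q : List Vertex → Set} {T} → SomeBag P T → AllBags Q T → ∃ λ b → P b × Q b
SomeBag-AllBags (here p) (node q _) = _ , p , q
SomeBag-AllBags (there ps) (node _ qs) = inChildren ps qs
  where
  inChildren : ∀ {P Q : List Vertex → Set} {Ts} → Any (SomeBag P) Ts → All (AllBags Q) Ts → ∃ λ b → P b × Q b
  inChildren (here p) (q ∷ _) = SomeBag-AllBags p q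
  inChildren (there ps) (_ ∷ qs) = inChildren ps qs

bag-overfull : ∀ {t b} (h : Vertex → ℕ) {z Zs} → length b ≤ suc t → All (z ≢_) Zs → Unique Zs →
               All (_∈ map h b) (z ∷ Zs) → suc t ≤ length Zs → ⊥
bag-overfull {t} {b} h |b|≤1+t z∉Zs Zs! inBag 1+t≤|Zs| =
  <-irrefl refl (≤-trans (s≤s 1+t≤|Zs|)
    (≤-trans (Unique-⊆⇒length≤ (z∉Zs ∷ Zs!) inBag) (subst (_≤ suc t) (sym (length-map h b)) |b|≤1+t)))

-- On the vertices of the biclique formula, label s reads off the variable a vertex stands for,
-- taking a clause ¬xᵢ ∨ yⱼ to its literal of polarity s.
label : Bool → Vertex → ℕ
label s (inj₁ x) = x
label s (inj₂ c) = polarVar c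
  where
  polarVar : Clause → ℕ
  polarVar [] = 0
  polarVar (l ∷ c) = if does (pos l Bool.≟ s) then var l else polarVar c

∈-nonempty : ∀ {A : Set} {n} {xs : List A} → suc n ≤ length xs → ∃ (_∈ xs)
∈-nonempty {xs = x ∷ _} _ = x , here refl

module Biclique (t k : ℕ) (Bs : List ℕ) (|Bs|≤k : length Bs ≤ k) where

  N : ℕ
  N = suc t + k

  X Y : List ℕ
  X = survivors Bs id N
  Y = survivors Bs (N +_) N

  F' : CNF
  F' = biclique N [ restrictTo Bs (λ _ → true) ]

  Ls : List Vertex
  Ls = map inj₁ (X ++ map (N +_) Y)

  x∈Ls : ∀ {i} → i ∈ X → inj₁ i ∈ Ls
  x∈Ls i∈X = ∈-map⁺ inj₁ (∈-++⁺ˡ i∈X)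

  y∈Ls : ∀ {j} → j ∈ Y → inj₁ (N + j) ∈ Ls
  y∈Ls j∈Y = ∈-map⁺ inj₁ (∈-++⁺ʳ X (∈-map⁺ (N +_) j∈Y))

  |X| : suc t ≤ length X
  |X| = length-survivors Bs id t k id |Bs|≤k

  |Y| : suc t ≤ length Y
  |Y| = length-survivors Bs (N +_) t k (+-cancelˡ-≡ N _ _) |Bs|≤k

  X! : Unique X
  X! = UniqueP.filter⁺ (λ i → id i ∉? Bs) (UniqueP.upTo⁺ N)

  Y! : Unique (map (N +_) Y)
  Y! = UniqueP.map⁺ (+-cancelˡ-≡ N _ _) (UniqueP.filter⁺ (λ j → N + j ∉? Bs) (UniqueP.upTo⁺ N))

  X<N : ∀ {i} → i ∈ X → i < N
  X<N = proj₁ ∘ survivor {Bs} {id}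

  clause∈F' : ∀ {i j} → i ∈ X → j ∈ Y → bicliqueClause N i j ∈ F'
  clause∈F' = biclique-survives {Bs} {N} (λ _ → true)

  x-partner : ∀ {b i j} → Blocks F' Ls (inj₁ i) b → i ∈ X → j ∈ Y → N + j ∈ map (label true) b
  x-partner {i = i} {j} blocks i∈X j∈Y =
    [ ∈-map⁺ (label true) , ∈-map⁺ (label true) ]
      (blocks {inj₂ (bicliqueClause N i j)} (y∈Ls j∈Y) (c∈F' , here refl) (c∈F' , there (here refl)))
    where
    c∈F' : bicliqueClause N i j ∈ F'
    c∈F' = clause∈F' i∈X j∈Y

  y-partner : ∀ {b i j} → Blocks F' Ls (inj₁ (N + j)) b → i ∈ X → j ∈ Y → i ∈ map (label false) b
  y-partner {i = i} {j} blocks i∈X j∈Y =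
    [ ∈-map⁺ (label false) , ∈-map⁺ (label false) ]
      (blocks {inj₂ (bicliqueClause N i j)} (x∈Ls i∈X) (c∈F' , there (here refl)) (c∈F' , here refl))
    where
    c∈F' : bicliqueClause N i j ∈ F'
    c∈F' = clause∈F' i∈X j∈Y

  start : ∀ {T} → (∀ v → IVertex F' v → Occurs v T) → Any (λ v → Occurs v T) Ls
  start vertices with ∈-nonempty |X| | ∈-nonempty |Y|
  ... | i , i∈X | j , j∈Y =
    Any.map (λ { refl → vertices (inj₁ i) (∈-vars⁺ (clause∈F' i∈X j∈Y) (here refl)) }) (x∈Ls i∈X)

  not-W : ¬ W t F'
  not-W (T , td@(_ , vertices , _ , _ , width))
    with SomeBag-AllBags (blockingBag-TD F' Ls td (start vertices)) width
  ... | b , (v , v∈Ls , v∈b , blocks) , |b|≤1+t with ∈-map⁻ inj₁ v∈Ls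
  ...   | z , z∈ , refl with ∈-++⁻ X z∈
  ...     | inj₁ i∈X =
    bag-overfull (label true) |b|≤1+t (AllP.map⁺ (All.universal (λ j → <⇒≢+ j (X<N i∈X)) Y)) Y!
      (∈-map⁺ _ v∈b ∷ AllP.map⁺ (All.tabulate (x-partner blocks i∈X)))
      (subst (suc t ≤_) (sym (length-map (N +_) Y)) |Y|)
  ...     | inj₂ y∈ with ∈-map⁻ (N +_) y∈
  ...       | j , j∈Y , refl =
    bag-overfull (label false) |b|≤1+t (All.tabulate (λ i∈X → <⇒≢+ j (X<N i∈X) ∘ sym)) X!
      (∈-map⁺ _ v∈b ∷ All.tabulate (λ i∈X → y-partner blocks i∈X j∈Y))
      |X|

size-doesNotDominate-depth : ∀ 𝒞 t → ¬ Dominates (SizeLE (W t)) (DepthLE ⟦ 𝒞 ⟧)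
size-doesNotDominate-depth 𝒞 t dominates with dominates ⟦ 𝒞 ⟧ (0 , λ _ _ inClass → base inClass)
... | k , size≤k with size≤k (biclique (suc t + k)) (biclique-WF _) (biclique-inClass 𝒞 _)
... | Bs , |Bs|≤k , _ , smallTD = Biclique.not-W t k Bs |Bs|≤k (smallTD (λ _ → true))

mainTheorem19 : ∀ (𝒞 : BaseClass) (t : ℕ) → 1 ≤ t →
    DominationOrthogonal (DepthLE ⟦ 𝒞 ⟧) (SizeLE (W t))
mainTheorem19 𝒞 t 1≤t = depth-doesNotDominate-size 𝒞 1≤t , size-doesNotDominate-depth 𝒞 t
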